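{- For $n\ge 2$, the homomorphism from the twin group $Tw_n$ to the cactus group $J_n$ defined by $s_{p,p+1}\mapsto s_{p,p+1}$ ($1\le p\le n-1$) is injective.
   Context: For $n \ge 2$, the cactus group $J_n$ is the group with generators $s_{p,q}$ for $1 \le p < q \le n$ and relations: (j1) $s_{p,q}^2 = 1$; (j2) $s_{p,q}s_{m,r} = s_{m,r}s_{p,q}$ whenever $[p,q]\cap[m,r]=\emptyset$; (j3) $s_{p,q}s_{m,r} = s_{p+q-r,\,p+q-m}\,s_{p,q}$ whenever $[m,r]\subset[p,q]$ (intervals of integers). The twin group $Tw_n$ is the group with generators $s_{p,p+1}$, $1\le p\le n-1$, and relations $s_{p,p+1}^2=1$ for all $p$ and $s_{p,p+1}s_{m,m+1}=s_{m,m+1}s_{p,p+1}$ whenever $|p-m|\ge 2$ (equivalently, it is the group generated by the 2-leaf generators $s_{p,p+1}$ with all relations (j1)–(j3) involving only them). -}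

module Defs where

open import Data.Nat using (ℕ; _+_; _∸_; _≤_; _<_)
open import Data.List using (List; []; _∷_; _++_; map)
open import Relation.Binary.PropositionalEquality using (_≡_)
open import Data.Sum using (_⊎_)
import Data.Nat
import Data.Nat.Properties

data Letter (G : Set) : Set where
  gen : G → Letter G
  inv : G → Letter G

Word : Set → Set
Word G = List (Letter G)

Relations : Set → Set₁
Relations G = Word G → Word G → Set

data PresEq {G : Set} (R : Relations G) : Word G → Word G → Set where
  rel    : ∀ u v {l r} → R l r → PresEq R (u ++ l ++ v) (u ++ r ++ v)
  cancel : ∀ u v x → PresEq R (u ++ gen x ∷ inv x ∷ v) (u ++ v)
  cancel′ : ∀ u v x → PresEq R (u ++ inv x ∷ gen x ∷ v) (u ++ v)
  ≈-refl  : ∀ {w} → PresEq R w w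
  ≈-sym   : ∀ {w w′} → PresEq R w w′ → PresEq R w′ w
  ≈-trans : ∀ {w w′ w″} → PresEq R w w′ → PresEq R w′ w″ → PresEq R w w″

mapWord : {G H : Set} → (G → H) → Word G → Word H
mapWord f = map λ { (gen x) → gen (f x) ; (inv x) → inv (f x) }

record CGen (n : ℕ) : Set where
  constructor s[_,_]
  field
    p q : ℕ
    {1≤p} : 1 ≤ p
    {p<q} : p < q
    {q≤n} : q ≤ n
open CGen public

data CactusRel (n : ℕ) : Relations (CGen n) where
  j1 : ∀ (g : CGen n) → CactusRel n (gen g ∷ gen g ∷ []) []
  j2 : ∀ (g h : CGen n) → (q g < p h ⊎ q h < p g) →
       CactusRel n (gen g ∷ gen h ∷ []) (gen h ∷ gen g ∷ [])
  j3 : ∀ (g h k : CGen n) → p g ≤ p h → q h ≤ q g →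
       p k ≡ p g + q g ∸ q h → q k ≡ p g + q g ∸ p h →
       CactusRel n (gen g ∷ gen h ∷ []) (gen k ∷ gen g ∷ [])

J-Eq : (n : ℕ) → Word (CGen n) → Word (CGen n) → Set
J-Eq n = PresEq (CactusRel n)

record TGen (n : ℕ) : Set where
  constructor t[_]
  field
    idx : ℕ
    {1≤idx} : 1 ≤ idx
    {idx<n} : idx + 1 ≤ n
open TGen public

data TwinRel (n : ℕ) : Relations (TGen n) where
  t1 : ∀ (a : TGen n) → TwinRel n (gen a ∷ gen a ∷ []) []
  t2 : ∀ (a b : TGen n) → (idx a + 2 ≤ idx b ⊎ idx b + 2 ≤ idx a) →
       TwinRel n (gen a ∷ gen b ∷ []) (gen b ∷ gen a ∷ [])

Tw-Eq : (n : ℕ) → Word (TGen n) → Word (TGen n) → Set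
Tw-Eq n = PresEq (TwinRel n)

ι : ∀ {n} → TGen n → CGen n
ι (t[ i ] {a} {b}) = s[ i , i + 1 ] {a} {Data.Nat.Properties.m<m+n i (Data.Nat.s≤s Data.Nat.z≤n)} {b}

-- Let W be the right-angled Coxeter group on involutions e_{a,b}, one for each pair {a,b} ⊆ ℕ,
-- in which e_A and e_B commute when A and B are disjoint; its elements are reduced words up to
-- commuting disjoint letters. The cactus group J_n acts on W × (ℕ → ℕ): s_{p,q} precomposes the
-- permutation π with the reversal of [p,q] and, when q = p + 1, also multiplies the W-component
-- by e_{π p, π q}. Relation (j3) holds because reversing [p,q] carries [m,r] onto
-- [p+q-r, p+q-m]. Starting from (1, id), the image of a twin word u reaches a state whose reduced
-- word can be spelled back, letter by letter, as a twin word: the spelling is Tw-equal to u,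
-- commuting two disjoint letters changes it by a twin relation, and injectivity of π makes it
-- unique. Hence twin words with J_n-equal images are Tw-equal.

module Submission where

open import Data.Empty using (⊥-elim)
open import Data.List using (List; []; _∷_; _++_; foldl)
open import Data.List.Properties using (foldl-++; ++-assoc; ++-identityʳ)
open import Data.Maybe using (Maybe; just; nothing; map)
open import Data.Maybe.Relation.Binary.Pointwise as Pointwise using (Pointwise; just; nothing)
open import Data.Nat using (ℕ; zero; suc; _+_; _∸_; _≤_; _<_; _≤?_; _⊓_; _⊔_; s≤s; z≤n; z<s)
open import Data.Nat.Properties
open import Data.Nat.Tactic.RingSolver using (solve-∀)
open import Data.Product using (Σ; _×_; _,_; proj₁; proj₂; swap)
open import Data.Product.Properties using (≡-dec; ,-injective)
open import Data.Product.Relation.Binary.Pointwise.NonDependent using (_×ₛ_)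
open import Data.Sum as Sum using (_⊎_; inj₁; inj₂)
open import Data.Unit using (⊤; tt)
open import Function using (_∘_; id; _⇔_; mk⇔; Equivalence)
open import Function.Definitions using (Injective)
open import Level using (0ℓ)
open import Relation.Binary.Bundles using (Setoid)
open import Relation.Binary.Core using (Rel)
open import Relation.Binary.Definitions using (DecidableEquality; Decidable; Symmetric)
open import Relation.Binary.PropositionalEquality
  using (_≡_; _≢_; ≢-sym; refl; sym; trans; cong; cong₂; subst; subst₂; _≗_; _→-setoid_; module ≡-Reasoning)
import Relation.Binary.Reasoning.Setoid
open import Relation.Nullary using (¬_; yes; no; ¬?; _×-dec_; contradiction)

open import Defs

map-≡nothing : ∀ {A B : Set} {f : A → B} m → map f m ≡ nothing → m ≡ nothing
map-≡nothing nothing _ = refl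

map-≡just : ∀ {A B : Set} {f : A → B} m {y} → map f m ≡ just y → Σ A λ x → m ≡ just x × f x ≡ y
map-≡just (just x) refl = x , refl , refl

presEq-++ʳ : ∀ {G : Set} {R : Relations G} {u v} w → PresEq R u v → PresEq R (u ++ w) (v ++ w)
presEq-++ʳ w (rel u v {l} {r} l~r) = subst₂ (PresEq _) (reassoc l) (reassoc r) (rel u (v ++ w) l~r)
  where
  reassoc : ∀ l → u ++ l ++ v ++ w ≡ (u ++ l ++ v) ++ w
  reassoc l = sym (trans (++-assoc u (l ++ v) w) (cong (u ++_) (++-assoc l v w)))
presEq-++ʳ w (cancel u v x)  =
  subst₂ (PresEq _) (sym (++-assoc u _ w)) (sym (++-assoc u v w)) (cancel u (v ++ w) x)
presEq-++ʳ w (cancel′ u v x) =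
  subst₂ (PresEq _) (sym (++-assoc u _ w)) (sym (++-assoc u v w)) (cancel′ u (v ++ w) x)
presEq-++ʳ w ≈-refl         = ≈-refl
presEq-++ʳ w (≈-sym e)      = ≈-sym (presEq-++ʳ w e)
presEq-++ʳ w (≈-trans e e′) = ≈-trans (presEq-++ʳ w e) (presEq-++ʳ w e′)

presEq-setoid : ∀ {G : Set} → Relations G → Setoid 0ℓ 0ℓ
presEq-setoid {G} R = record
  { Carrier       = Word G
  ; _≈_           = PresEq R
  ; isEquivalence = record { refl = ≈-refl ; sym = ≈-sym ; trans = ≈-trans }
  }

presEq-relʳ : ∀ {G : Set} {R : Relations G} u {l r} → R l r → PresEq R (u ++ l) (u ++ r)
presEq-relʳ u {l} {r} l~r =
  subst₂ (PresEq _) (cong (u ++_) (++-identityʳ l)) (cong (u ++_) (++-identityʳ r)) (rel u [] l~r)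

inv≈gen : ∀ {G : Set} {R : Relations G} {x} → R (gen x ∷ gen x ∷ []) [] →
          ∀ u v → PresEq R (u ++ inv x ∷ v) (u ++ gen x ∷ v)
inv≈gen {x = x} xx≈1 u v = ≈-trans (≈-sym insert-xx) (cancel′ u (gen x ∷ v) x)
  where
  insert-xx : PresEq _ (u ++ inv x ∷ gen x ∷ gen x ∷ v) (u ++ inv x ∷ v)
  insert-xx = subst₂ (PresEq _) (++-assoc u _ _) (++-assoc u _ _) (rel (u ++ inv x ∷ []) v xx≈1)

-- Right-angled Coxeter groups

module RightAngledCoxeter {A : Set} (_≟_ : DecidableEquality A)
  (_#_ : Rel A 0ℓ) (_#?_ : Decidable _#_) (#-sym : Symmetric _#_) (#-irrefl : ∀ {a} → ¬ a # a) where

  data Interaction (a b : A) : Set where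
    same    : a ≡ b → Interaction a b
    apart   : a # b → Interaction a b
    blocked : a ≢ b → ¬ a # b → Interaction a b

  interaction : ∀ a b → Interaction a b
  interaction a b with a ≟ b | a #? b
  ... | yes a≡b | _       = same a≡b
  ... | no  _   | yes a#b = apart a#b
  ... | no  a≢b | no ¬a#b = blocked a≢b ¬a#b

  remove : A → List A → Maybe (List A)
  remove a []      = nothing
  remove a (b ∷ w) with interaction a b
  ... | same _      = just w
  ... | apart _     = map (b ∷_) (remove a w)
  ... | blocked _ _ = nothing

  infix 4 _≋_
  data _≋_ : Rel (List A) 0ℓ where
    ≋-refl  : ∀ {w} → w ≋ w
    ≋-trans : ∀ {u v w} → u ≋ v → v ≋ w → u ≋ w
    ≋-swap  : ∀ {a b w} → a # b → a ∷ b ∷ w ≋ b ∷ a ∷ w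
    ≋-cons  : ∀ {a w w′} → w ≋ w′ → a ∷ w ≋ a ∷ w′

  ≋-sym : ∀ {u v} → u ≋ v → v ≋ u
  ≋-sym ≋-refl        = ≋-refl
  ≋-sym (≋-trans p q) = ≋-trans (≋-sym q) (≋-sym p)
  ≋-sym (≋-swap a#b)  = ≋-swap (#-sym a#b)
  ≋-sym (≋-cons p)    = ≋-cons (≋-sym p)

  remove-same : ∀ a w → remove a (a ∷ w) ≡ just w
  remove-same a w with interaction a a
  ... | same _        = refl
  ... | apart a#a     = ⊥-elim (#-irrefl a#a)
  ... | blocked a≢a _ = ⊥-elim (a≢a refl)

  remove-apart : ∀ {a b} w → a # b → remove a (b ∷ w) ≡ map (b ∷_) (remove a w)
  remove-apart {a} {b} w a#b with interaction a b
  ... | same refl       = ⊥-elim (#-irrefl a#b)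
  ... | apart _         = refl
  ... | blocked _ ¬a#b  = ⊥-elim (¬a#b a#b)

  remove-blocked : ∀ {a b} w → a ≢ b → ¬ a # b → remove a (b ∷ w) ≡ nothing
  remove-blocked {a} {b} w a≢b ¬a#b with interaction a b
  ... | same a≡b    = ⊥-elim (a≢b a≡b)
  ... | apart a#b   = ⊥-elim (¬a#b a#b)
  ... | blocked _ _ = refl

  remove-apart-nothing : ∀ {a b} w → a # b → remove a w ≡ nothing → remove a (b ∷ w) ≡ nothing
  remove-apart-nothing w a#b a∉w = trans (remove-apart w a#b) (cong (map _) a∉w)

  remove-apart-just : ∀ {a b} w {x} → a # b → remove a w ≡ just x → remove a (b ∷ w) ≡ just (b ∷ x)
  remove-apart-just w a#b a∈w = trans (remove-apart w a#b) (cong (map _) a∈w)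

  map-cons-resp-≋ : ∀ b {m m′} → Pointwise _≋_ m m′ → Pointwise _≋_ (map (b ∷_) m) (map (b ∷_) m′)
  map-cons-resp-≋ b (just p) = just (≋-cons p)
  map-cons-resp-≋ b nothing  = nothing

  remove-swap : ∀ a {c d} w → c # d → Pointwise _≋_ (remove a (c ∷ d ∷ w)) (remove a (d ∷ c ∷ w))
  remove-swap a {c} {d} w c#d with interaction a c | interaction a d
  ... | same refl     | same refl     = ⊥-elim (#-irrefl c#d)
  ... | same refl     | apart _       rewrite remove-same a w = just ≋-refl
  ... | same refl     | blocked _ ¬#  = ⊥-elim (¬# c#d)
  ... | apart _       | same refl     rewrite remove-same a w = just ≋-refl
  ... | apart a#c     | apart a#d     rewrite remove-apart w a#c | remove-apart w a#d with remove a w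
  ...   | just v  = just (≋-swap c#d)
  ...   | nothing = nothing
  remove-swap a {c} {d} w c#d | apart a#c | blocked a≢d ¬# rewrite remove-blocked w a≢d ¬# = nothing
  remove-swap a {c} {d} w c#d | blocked _ ¬# | same refl = ⊥-elim (¬# (#-sym c#d))
  remove-swap a {c} {d} w c#d | blocked a≢c ¬# | apart a#d rewrite remove-blocked w a≢c ¬# = nothing
  remove-swap a {c} {d} w c#d | blocked _ _ | blocked _ _ = nothing

  remove-resp-≋ : ∀ a {w w′} → w ≋ w′ → Pointwise _≋_ (remove a w) (remove a w′)
  remove-resp-≋ a ≋-refl          = Pointwise.refl ≋-refl
  remove-resp-≋ a (≋-trans p q)   = Pointwise.trans ≋-trans (remove-resp-≋ a p) (remove-resp-≋ a q)
  remove-resp-≋ a (≋-swap c#d)    = remove-swap a _ c#d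
  remove-resp-≋ a (≋-cons {b} p) with interaction a b
  ... | same _      = just p
  ... | apart _     = map-cons-resp-≋ b (remove-resp-≋ a p)
  ... | blocked _ _ = nothing

  ≋-reflexive : ∀ {u v} → u ≡ v → u ≋ v
  ≋-reflexive refl = ≋-refl

  ≋-setoid : Setoid 0ℓ 0ℓ
  ≋-setoid = record
    { Carrier       = List A
    ; _≈_           = _≋_
    ; isEquivalence = record { refl = ≋-refl ; sym = ≋-sym ; trans = ≋-trans }
    }

  module ≋-Reasoning = Relation.Binary.Reasoning.Setoid ≋-setoid

  remove-sound : ∀ a w {x} → remove a w ≡ just x → a ∷ x ≋ w
  remove-sound a (b ∷ w) eq with interaction a b
  remove-sound a (b ∷ w) refl | same refl = ≋-refl
  remove-sound a (b ∷ w) eq   | apart a#b with remove a w in eq′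
  remove-sound a (b ∷ w) refl | apart a#b | just _ = ≋-trans (≋-swap a#b) (≋-cons (remove-sound a w eq′))

  remove-stays-nothing : ∀ {a c} w {x} → a # c →
                         remove c w ≡ nothing → remove a w ≡ just x → remove c x ≡ nothing
  remove-stays-nothing {a} {c} (b ∷ w) a#c c∉w a∈w with interaction a b
  remove-stays-nothing {a} {c} (b ∷ w) a#c c∉w refl | same refl =
    map-≡nothing (remove c w) (trans (sym (remove-apart w (#-sym a#c))) c∉w)
  remove-stays-nothing {a} {c} (b ∷ w) a#c c∉w a∈w | apart a#b with map-≡just (remove a w) a∈w
  ... | y , a∈w′ , refl with interaction c b
  ...   | same refl with () ← c∉w
  ...   | apart c#b = cong (map (b ∷_)) (remove-stays-nothing w a#c (map-≡nothing (remove c w) c∉w) a∈w′)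
  ...   | blocked _ _ = refl

  remove-comm : ∀ {a b} w {x y} → a # b → remove a w ≡ just x → remove b w ≡ just y →
                Σ (List A) λ z → remove b x ≡ just z × remove a y ≡ just z
  remove-comm {a} {b} (c ∷ w) a#b a∈w b∈w with interaction a c
  remove-comm {a} {b} (c ∷ w) a#b refl b∈w | same refl
    with map-≡just (remove b w) (trans (sym (remove-apart w (#-sym a#b))) b∈w)
  ... | y , b∈w′ , refl = y , b∈w′ , remove-same a y
  remove-comm {a} {b} (c ∷ w) a#b a∈w b∈w | apart a#c with map-≡just (remove a w) a∈w | interaction b c
  remove-comm (c ∷ w) a#b a∈w refl | apart a#c | x , a∈w′ , refl | same refl = x , remove-same _ x , a∈w′
  remove-comm {a} {b} (c ∷ w) a#b a∈w b∈w | apart a#c | x , a∈w′ , refl | apart b#c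
    with map-≡just (remove b w) b∈w
  ... | y , b∈w′ , refl with remove-comm w a#b a∈w′ b∈w′
  ...   | z , b∈x , a∈y = c ∷ z , remove-apart-just x b#c b∈x , remove-apart-just y a#c a∈y

  Reduced : List A → Set
  Reduced []      = ⊤
  Reduced (a ∷ w) = remove a w ≡ nothing × Reduced w

  reduced-resp-≋ : ∀ {w w′} → w ≋ w′ → Reduced w → Reduced w′
  reduced-resp-≋ ≋-refl        r = r
  reduced-resp-≋ (≋-trans p q) r = reduced-resp-≋ q (reduced-resp-≋ p r)
  reduced-resp-≋ (≋-swap {c} {d} {w} c#d) (c∉dw , d∉w , r) =
    remove-apart-nothing w (#-sym c#d) d∉w ,
    map-≡nothing (remove c w) (trans (sym (remove-apart w c#d)) c∉dw) , r
  reduced-resp-≋ (≋-cons {a} p) (a∉w , r) =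
    Pointwise.nothing-inv (subst (λ m → Pointwise _≋_ m _) a∉w (remove-resp-≋ a p)) , reduced-resp-≋ p r

  reduced-remove : ∀ a w {x} → Reduced w → remove a w ≡ just x → Reduced x
  reduced-remove a (b ∷ w) (b∉w , r) a∈w with interaction a b
  reduced-remove a (b ∷ w) (b∉w , r) refl | same refl = r
  reduced-remove a (b ∷ w) (b∉w , r) a∈w  | apart a#b with map-≡just (remove a w) a∈w
  ... | x , a∈w′ , refl = remove-stays-nothing w a#b b∉w a∈w′ , reduced-remove a w r a∈w′

  -- Left multiplication by the generator a, on reduced representatives.
  act : A → List A → List A
  act a w with remove a w
  ... | just x  = x
  ... | nothing = a ∷ w

  act-just : ∀ a w {x} → remove a w ≡ just x → act a w ≡ x
  act-just a w a∈w with remove a w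
  act-just a w refl | just _ = refl

  act-nothing : ∀ a w → remove a w ≡ nothing → act a w ≡ a ∷ w
  act-nothing a w a∉w with remove a w
  act-nothing a w refl | nothing = refl

  act-resp-≋ : ∀ a {w w′} → w ≋ w′ → act a w ≋ act a w′
  act-resp-≋ a {w} {w′} p with remove a w | remove a w′ | remove-resp-≋ a p
  ... | just _  | just _  | just q  = q
  ... | nothing | nothing | nothing = ≋-cons p

  act-reduced : ∀ a {w} → Reduced w → Reduced (act a w)
  act-reduced a {w} r with remove a w in a∈w
  ... | just _  = reduced-remove a w r a∈w
  ... | nothing = a∈w , r

  act-involutive : ∀ a {w} → Reduced w → act a (act a w) ≋ w
  act-involutive a {w} r with remove a w in a∈w
  ... | nothing = ≋-reflexive (act-just a (a ∷ w) (remove-same a w))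
  ... | just x  = begin
    act a x ≡⟨ act-nothing a x (proj₁ (reduced-resp-≋ (≋-sym (remove-sound a w a∈w)) r)) ⟩
    a ∷ x   ≈⟨ remove-sound a w a∈w ⟩
    w       ∎
    where open ≋-Reasoning

  act-comm : ∀ {a b} w → a # b → act a (act b w) ≋ act b (act a w)
  act-comm {a} {b} w a#b with remove b w in b∈w | remove a w in a∈w
  ... | nothing | nothing = begin
    act a (b ∷ w) ≡⟨ act-nothing a (b ∷ w) (remove-apart-nothing w a#b a∈w) ⟩
    a ∷ b ∷ w     ≈⟨ ≋-swap a#b ⟩
    b ∷ a ∷ w     ≡⟨ act-nothing b (a ∷ w) (remove-apart-nothing w (#-sym a#b) b∈w) ⟨
    act b (a ∷ w) ∎
    where open ≋-Reasoning
  ... | just y  | nothing = ≋-reflexive (begin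
    act a y       ≡⟨ act-nothing a y (remove-stays-nothing w (#-sym a#b) a∈w b∈w) ⟩
    a ∷ y         ≡⟨ act-just b (a ∷ w) (remove-apart-just w (#-sym a#b) b∈w) ⟨
    act b (a ∷ w) ∎)
    where open ≡-Reasoning
  ... | nothing | just x  = ≋-reflexive (begin
    act a (b ∷ w) ≡⟨ act-just a (b ∷ w) (remove-apart-just w a#b a∈w) ⟩
    b ∷ x         ≡⟨ act-nothing b x (remove-stays-nothing w a#b b∈w a∈w) ⟨
    act b x       ∎)
    where open ≡-Reasoning
  ... | just y  | just x with remove-comm w a#b a∈w b∈w
  ...   | z , b∈x , a∈y = ≋-reflexive (trans (act-just a y a∈y) (sym (act-just b x b∈x)))

Edge : Set
Edge = ℕ × ℕ

edge : ℕ → ℕ → Edge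
edge a b = a ⊓ b , a ⊔ b

_#_ : Rel Edge 0ℓ
(a , b) # (c , d) = a ≢ c × a ≢ d × b ≢ c × b ≢ d

_#?_ : Decidable _#_
(a , b) #? (c , d) = ¬? (a ≟ c) ×-dec ¬? (a ≟ d) ×-dec ¬? (b ≟ c) ×-dec ¬? (b ≟ d)

#-sym : Symmetric _#_
#-sym (a≢c , a≢d , b≢c , b≢d) = ≢-sym a≢c , ≢-sym b≢c , ≢-sym a≢d , ≢-sym b≢d

#-irrefl : ∀ {e} → ¬ e # e
#-irrefl (a≢a , _) = a≢a refl

open RightAngledCoxeter (≡-dec _≟_ _≟_) _#_ _#?_ #-sym #-irrefl

edge-comm : ∀ a b → edge a b ≡ edge b a
edge-comm a b = cong₂ _,_ (⊓-comm a b) (⊔-comm a b)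

edge-ordered : ∀ a b → edge a b ≡ (a , b) ⊎ edge a b ≡ (b , a)
edge-ordered a b with ≤-total a b
... | inj₁ a≤b = inj₁ (cong₂ _,_ (m≤n⇒m⊓n≡m a≤b) (m≤n⇒m⊔n≡n a≤b))
... | inj₂ b≤a = inj₂ (cong₂ _,_ (m≥n⇒m⊓n≡n b≤a) (m≥n⇒m⊔n≡m b≤a))

edge-injective : ∀ {a b c d} → edge a b ≡ edge c d → a ≡ c × b ≡ d ⊎ a ≡ d × b ≡ c
edge-injective {a} {b} {c} {d} eq with edge-ordered a b | edge-ordered c d
... | inj₁ ab | inj₁ cd = inj₁ (,-injective (trans (sym ab) (trans eq cd)))
... | inj₁ ab | inj₂ dc = inj₂ (,-injective (trans (sym ab) (trans eq dc)))
... | inj₂ ba | inj₁ cd = inj₂ (swap (,-injective (trans (sym ba) (trans eq cd))))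
... | inj₂ ba | inj₂ dc = inj₁ (swap (,-injective (trans (sym ba) (trans eq dc))))

#-swapˡ : ∀ {a b e} → (a , b) # e → (b , a) # e
#-swapˡ (a≢c , a≢d , b≢c , b≢d) = b≢c , b≢d , a≢c , a≢d

#-swapʳ : ∀ {e c d} → e # (c , d) → e # (d , c)
#-swapʳ = #-sym ∘ #-swapˡ ∘ #-sym

edge-#⇔ : ∀ a b c d → (a , b) # (c , d) ⇔ edge a b # edge c d
edge-#⇔ a b c d with edge-ordered a b | edge-ordered c d
... | inj₁ ab | inj₁ cd = mk⇔ (subst₂ _#_ (sym ab) (sym cd)) (subst₂ _#_ ab cd)
... | inj₁ ab | inj₂ dc = mk⇔ (subst₂ _#_ (sym ab) (sym dc) ∘ #-swapʳ) (#-swapʳ ∘ subst₂ _#_ ab dc)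
... | inj₂ ba | inj₁ cd = mk⇔ (subst₂ _#_ (sym ba) (sym cd) ∘ #-swapˡ) (#-swapˡ ∘ subst₂ _#_ ba cd)
... | inj₂ ba | inj₂ dc =
  mk⇔ (subst₂ _#_ (sym ba) (sym dc) ∘ #-swapˡ ∘ #-swapʳ) (#-swapˡ ∘ #-swapʳ ∘ subst₂ _#_ ba dc)

-- Reversal of intervals

reflect : ℕ → ℕ → ℕ → ℕ
reflect p q i with p ≤? i | i ≤? q
... | yes _ | yes _ = p + q ∸ i
... | _     | _     = i

data Position (p q i : ℕ) : Set where
  inside  : p ≤ i → i ≤ q → Position p q i
  outside : i < p ⊎ q < i → Position p q i

position : ∀ p q i → Position p q i
position p q i with p ≤? i | i ≤? q
... | yes p≤i | yes i≤q = inside p≤i i≤q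
... | no  p≰i | _       = outside (inj₁ (≰⇒> p≰i))
... | yes _   | no  i≰q = outside (inj₂ (≰⇒> i≰q))

reflect-inside : ∀ {p q i} → p ≤ i → i ≤ q → reflect p q i ≡ p + q ∸ i
reflect-inside {p} {q} {i} p≤i i≤q with p ≤? i | i ≤? q
... | yes _  | yes _   = refl
... | no p≰i | _       = contradiction p≤i p≰i
... | yes _  | no i≰q  = contradiction i≤q i≰q

reflect-outside : ∀ p q {i} → i < p ⊎ q < i → reflect p q i ≡ i
reflect-outside p q {i} i∉ with p ≤? i | i ≤? q
... | no _    | _       = refl
... | yes _   | no _    = refl
... | yes p≤i | yes i≤q with i∉
...   | inj₁ i<p = contradiction p≤i (<⇒≱ i<p)
...   | inj₂ q<i = contradiction i≤q (<⇒≱ q<i)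

reflect-+ : ∀ {p q i} → p ≤ i → i ≤ q → reflect p q i + i ≡ p + q
reflect-+ {p} p≤i i≤q rewrite reflect-inside p≤i i≤q = m∸n+n≡m (≤-trans i≤q (m≤n+m _ p))

reflect-≡ : ∀ {p q i j} → p ≤ i → i ≤ q → j + i ≡ p + q → reflect p q i ≡ j
reflect-≡ {i = i} {j} p≤i i≤q j+i≡p+q =
  trans (reflect-inside p≤i i≤q) (trans (cong (_∸ i) (sym j+i≡p+q)) (m+n∸n≡m j i))

∸-inside : ∀ {p q i} → p ≤ i → i ≤ q → p ≤ p + q ∸ i × p + q ∸ i ≤ q
∸-inside {p} {q} {i} p≤i i≤q =
  subst (_≤ p + q ∸ i) (m+n∸n≡m p q) (∸-monoʳ-≤ (p + q) i≤q) ,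
  subst (p + q ∸ i ≤_) (m+n∸m≡n p q) (∸-monoʳ-≤ (p + q) p≤i)

reflect-stays-inside : ∀ {p q i} → p ≤ i → i ≤ q → p ≤ reflect p q i × reflect p q i ≤ q
reflect-stays-inside p≤i i≤q rewrite reflect-inside p≤i i≤q = ∸-inside p≤i i≤q

reflect-start : ∀ {p q} → p ≤ q → reflect p q p ≡ q
reflect-start {p} {q} p≤q = reflect-≡ ≤-refl p≤q (+-comm q p)

reflect-end : ∀ {p q} → p ≤ q → reflect p q q ≡ p
reflect-end p≤q = reflect-≡ p≤q ≤-refl refl

reflect-involutive : ∀ p q i → reflect p q (reflect p q i) ≡ i
reflect-involutive p q i with position p q i
... | inside p≤i i≤q =
  let p≤j , j≤q = reflect-stays-inside p≤i i≤q
  in reflect-≡ p≤j j≤q (trans (+-comm i _) (reflect-+ p≤i i≤q))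
... | outside i∉ = trans (cong (reflect p q) (reflect-outside p q i∉)) (reflect-outside p q i∉)

reflect-injective : ∀ p q → Injective _≡_ _≡_ (reflect p q)
reflect-injective p q {i} {j} eq =
  trans (sym (reflect-involutive p q i)) (trans (cong (reflect p q) eq) (reflect-involutive p q j))

reflect-comm : ∀ {p q p′ q′} → q < p′ →
               ∀ i → reflect p q (reflect p′ q′ i) ≡ reflect p′ q′ (reflect p q i)
reflect-comm {p} {q} {p′} {q′} q<p′ i with position p q i | position p′ q′ i
... | inside p≤i i≤q | _ rewrite reflect-outside p′ q′ (inj₁ (≤-<-trans i≤q q<p′)) =
  sym (reflect-outside p′ q′ (inj₁ (≤-<-trans (proj₂ (reflect-stays-inside p≤i i≤q)) q<p′)))
... | outside _ | inside p′≤i i≤q′ rewrite reflect-outside p q (inj₂ (<-≤-trans q<p′ p′≤i)) =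
  reflect-outside p q (inj₂ (<-≤-trans q<p′ (proj₁ (reflect-stays-inside p′≤i i≤q′))))
... | outside i∉ | outside i∉′ rewrite reflect-outside p′ q′ i∉′ | reflect-outside p q i∉ =
  sym (reflect-outside p′ q′ i∉′)

+-shuffle : ∀ a b c d → (a + b) + (c + d) ≡ (a + d) + (b + c)
+-shuffle = solve-∀

outside-⊆ : ∀ {p q m r i} → p ≤ m → r ≤ q → i < p ⊎ q < i → i < m ⊎ r < i
outside-⊆ p≤m r≤q = Sum.map (λ i<p → <-≤-trans i<p p≤m) (≤-<-trans r≤q)

∸-outside : ∀ {P m r i} → m ≤ P → i ≤ P → i < m ⊎ r < i → P ∸ i < P ∸ r ⊎ P ∸ m < P ∸ i
∸-outside m≤P i≤P (inj₁ i<m) = inj₂ (∸-monoʳ-< i<m m≤P)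
∸-outside m≤P i≤P (inj₂ r<i) = inj₁ (∸-monoʳ-< r<i i≤P)

reflect-conj : ∀ {p q m r} → p ≤ m → m ≤ r → r ≤ q →
  ∀ i → reflect p q (reflect m r i) ≡ reflect (p + q ∸ r) (p + q ∸ m) (reflect p q i)
reflect-conj {p} {q} {m} {r} p≤m m≤r r≤q i with position p q i
... | outside i∉
  rewrite reflect-outside p q i∉ | reflect-outside m r (outside-⊆ p≤m r≤q i∉) | reflect-outside p q i∉ =
  sym (reflect-outside (p + q ∸ r) (p + q ∸ m) (outside-⊆ p≤p+q∸r p+q∸m≤q i∉))
  where
  p≤p+q∸r = proj₁ (∸-inside (≤-trans p≤m m≤r) r≤q)
  p+q∸m≤q = proj₂ (∸-inside p≤m (≤-trans m≤r r≤q))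
... | inside p≤i i≤q with position m r i
...   | outside i∉ rewrite reflect-outside m r i∉ | reflect-inside p≤i i≤q =
  sym (reflect-outside (p + q ∸ r) (p + q ∸ m)
                       (∸-outside (m≤n⇒m≤o+n p (≤-trans m≤r r≤q)) (m≤n⇒m≤o+n p i≤q) i∉))
...   | inside m≤i i≤r = sym (reflect-≡ X≤i′ i′≤Y k+i′≡X+Y)
  where
  P = p + q
  X = P ∸ r
  Y = P ∸ m
  j = reflect m r i
  i′ = reflect p q i
  k = reflect p q j
  j∈[p,q] : p ≤ j × j ≤ q
  j∈[p,q] = let m≤j , j≤r = reflect-stays-inside m≤i i≤r in ≤-trans p≤m m≤j , ≤-trans j≤r r≤q
  X≤i′ : X ≤ i′
  X≤i′ = subst (X ≤_) (sym (reflect-inside p≤i i≤q)) (∸-monoʳ-≤ P i≤r)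
  i′≤Y : i′ ≤ Y
  i′≤Y = subst (_≤ Y) (sym (reflect-inside p≤i i≤q)) (∸-monoʳ-≤ P m≤i)
  -- After adding i + j both sides are 2(p + q), which sidesteps the truncated subtractions.
  k+i′≡X+Y : k + i′ ≡ X + Y
  k+i′≡X+Y = +-cancelʳ-≡ (i + j) (k + i′) (X + Y) (begin
    (k + i′) + (i + j) ≡⟨ +-shuffle k i′ i j ⟩
    (k + j) + (i′ + i) ≡⟨ cong₂ _+_ (reflect-+ (proj₁ j∈[p,q]) (proj₂ j∈[p,q])) (reflect-+ p≤i i≤q) ⟩
    P + P              ≡⟨ cong₂ _+_ (m∸n+n≡m (m≤n⇒m≤o+n p r≤q))
                                    (m∸n+n≡m (m≤n⇒m≤o+n p (≤-trans m≤r r≤q))) ⟨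
    (X + r) + (Y + m)  ≡⟨ +-shuffle X Y m r ⟨
    (X + Y) + (m + r)  ≡⟨ cong (X + Y +_) (trans (+-comm i j) (reflect-+ m≤i i≤r)) ⟨
    (X + Y) + (i + j)  ∎)
    where open ≡-Reasoning

∸-suc⇔ : ∀ {P x y} → x ≤ P → y ≤ P → y ≡ suc x ⇔ P ∸ x ≡ suc (P ∸ y)
∸-suc⇔ {P} {x} {y} x≤P y≤P = mk⇔ to from
  where
  to : y ≡ suc x → P ∸ x ≡ suc (P ∸ y)
  to refl = +-cancelʳ-≡ x (P ∸ x) (suc (P ∸ y))
    (trans (m∸n+n≡m x≤P) (trans (sym (m∸n+n≡m y≤P)) (+-suc (P ∸ y) x)))
  from : P ∸ x ≡ suc (P ∸ y) → y ≡ suc x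
  from eq = sym (+-cancelˡ-≡ (P ∸ y) (suc x) y (begin
    P ∸ y + suc x   ≡⟨ +-suc (P ∸ y) x ⟩
    suc (P ∸ y) + x ≡⟨ cong (_+ x) eq ⟨
    P ∸ x + x       ≡⟨ m∸n+n≡m x≤P ⟩
    P               ≡⟨ m∸n+n≡m y≤P ⟨
    P ∸ y + y       ∎))
    where open ≡-Reasoning

mirror-adjacent⇔ : ∀ {p q m r} → m < r → r ≤ q → r ≡ suc m ⇔ p + q ∸ m ≡ suc (p + q ∸ r)
mirror-adjacent⇔ {p} m<r r≤q = ∸-suc⇔ (m≤n⇒m≤o+n p (≤-trans (<⇒≤ m<r) r≤q)) (m≤n⇒m≤o+n p r≤q)

-- The action of the cactus group

State : Set
State = List Edge × (ℕ → ℕ)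

State-setoid : Setoid 0ℓ 0ℓ
State-setoid = ≋-setoid ×ₛ (ℕ →-setoid ℕ)

open Setoid State-setoid using ()
  renaming (_≈_ to _≃_; refl to ≃-refl; sym to ≃-sym; trans to ≃-trans)

WellFormed : State → Set
WellFormed (w , π) = Reduced w × Injective _≡_ _≡_ π

actIfAdjacent : ℕ → ℕ → (ℕ → ℕ) → List Edge → List Edge
actIfAdjacent p q π w with q ≟ suc p
... | yes _ = act (edge (π p) (π q)) w
... | no  _ = w

step : ℕ → ℕ → State → State
step p q (w , π) = actIfAdjacent p q π w , π ∘ reflect p q

step-wellFormed : ∀ p q {x} → WellFormed x → WellFormed (step p q x)
step-wellFormed p q {w , π} (r , π-inj) = reduced , reflect-injective p q ∘ π-inj
  where
  reduced : Reduced (actIfAdjacent p q π w)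
  reduced with q ≟ suc p
  ... | yes _ = act-reduced _ r
  ... | no  _ = r

step-resp-≃ : ∀ p q {x y} → x ≃ y → step p q x ≃ step p q y
step-resp-≃ p q {w , π} {w′ , π′} (w≋w′ , π≗π′) = words , π≗π′ ∘ reflect p q
  where
  words : actIfAdjacent p q π w ≋ actIfAdjacent p q π′ w′
  words with q ≟ suc p
  ... | yes _ = ≋-trans (act-resp-≋ _ w≋w′)
                        (≋-reflexive (cong₂ (λ a b → act (edge a b) w′) (π≗π′ p) (π≗π′ q)))
  ... | no  _ = w≋w′

step-involutive : ∀ {p q} → p ≤ q → ∀ {x} → WellFormed x → step p q (step p q x) ≃ x
step-involutive {p} {q} p≤q {w , π} (r , _) = words , cong π ∘ reflect-involutive p q
  where
  same-edge : edge (π (reflect p q p)) (π (reflect p q q)) ≡ edge (π p) (π q)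
  same-edge = trans (cong₂ (λ a b → edge (π a) (π b)) (reflect-start p≤q) (reflect-end p≤q))
                    (edge-comm (π q) (π p))
  words : actIfAdjacent p q (π ∘ reflect p q) (actIfAdjacent p q π w) ≋ w
  words with q ≟ suc p
  ... | yes _ = ≋-trans (≋-reflexive (cong (λ e → act e (act (edge (π p) (π q)) w)) same-edge))
                        (act-involutive (edge (π p) (π q)) r)
  ... | no  _ = ≋-refl

injective-edge-# : ∀ {π : ℕ → ℕ} → Injective _≡_ _≡_ π → ∀ {a b c d} →
  a ≢ c → a ≢ d → b ≢ c → b ≢ d → edge (π a) (π b) # edge (π c) (π d)
injective-edge-# π-inj a≢c a≢d b≢c b≢d =
  Equivalence.to (edge-#⇔ _ _ _ _) (a≢c ∘ π-inj , a≢d ∘ π-inj , b≢c ∘ π-inj , b≢d ∘ π-inj)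

reflect-outside-edge : ∀ (π : ℕ → ℕ) p q {a b} → a < p ⊎ q < a → b < p ⊎ q < b →
  edge (π (reflect p q a)) (π (reflect p q b)) ≡ edge (π a) (π b)
reflect-outside-edge π p q a∉ b∉ =
  cong₂ (λ x y → edge (π x) (π y)) (reflect-outside p q a∉) (reflect-outside p q b∉)

step-comm : ∀ {p q p′ q′} → p < q → q < p′ → p′ < q′ → ∀ {w π} → Injective _≡_ _≡_ π →
  step p′ q′ (step p q (w , π)) ≃ step p q (step p′ q′ (w , π))
step-comm {p} {q} {p′} {q′} p<q q<p′ p′<q′ {w} {π} π-inj =
  words , cong π ∘ reflect-comm {p} {q} {p′} {q′} q<p′
  where
  e  = edge (π p) (π q)
  e′ = edge (π p′) (π q′)
  e-fixed : edge (π (reflect p′ q′ p)) (π (reflect p′ q′ q)) ≡ e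
  e-fixed = reflect-outside-edge π p′ q′ (inj₁ (<-trans p<q q<p′)) (inj₁ q<p′)
  e′-fixed : edge (π (reflect p q p′)) (π (reflect p q q′)) ≡ e′
  e′-fixed = reflect-outside-edge π p q (inj₂ q<p′) (inj₂ (<-trans q<p′ p′<q′))
  e#e′ : e # e′
  e#e′ = injective-edge-# π-inj (<⇒≢ (<-trans p<q q<p′)) (<⇒≢ (<-trans (<-trans p<q q<p′) p′<q′))
                                 (<⇒≢ q<p′) (<⇒≢ (<-trans q<p′ p′<q′))
  words : actIfAdjacent p′ q′ (π ∘ reflect p q) (actIfAdjacent p q π w) ≋
          actIfAdjacent p q (π ∘ reflect p′ q′) (actIfAdjacent p′ q′ π w)
  words with q ≟ suc p | q′ ≟ suc p′
  ... | yes _ | yes _ = begin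
    act (edge (π (reflect p q p′)) (π (reflect p q q′))) (act e w)
      ≡⟨ cong (λ f → act f (act e w)) e′-fixed ⟩
    act e′ (act e w)
      ≈⟨ act-comm w (#-sym e#e′) ⟩
    act e (act e′ w)
      ≡⟨ cong (λ f → act f (act e′ w)) e-fixed ⟨
    act (edge (π (reflect p′ q′ p)) (π (reflect p′ q′ q))) (act e′ w)
      ∎
    where open ≋-Reasoning
  ... | yes _ | no  _ = ≋-reflexive (cong (λ f → act f w) (sym e-fixed))
  ... | no  _ | yes _ = ≋-reflexive (cong (λ f → act f w) e′-fixed)
  ... | no  _ | no  _ = ≋-refl

nested-in-adjacent : ∀ {p q m r} → p ≤ m → m < r → r ≤ q → q ≡ suc p → m ≡ p × r ≡ q
nested-in-adjacent p≤m m<r r≤q refl =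
  ≤-antisym (≤-pred (≤-trans m<r r≤q)) p≤m , ≤-antisym r≤q (≤-trans (s≤s p≤m) m<r)

step-conj-strict : ∀ {p q m r} → q ≢ suc p → p ≤ m → m < r → r ≤ q → ∀ {w π} →
  step m r (step p q (w , π)) ≃ step p q (step (p + q ∸ r) (p + q ∸ m) (w , π))
step-conj-strict {p} {q} {m} {r} q≢1+p p≤m m<r r≤q {w} {π} =
  words , cong π ∘ reflect-conj p≤m (<⇒≤ m<r) r≤q
  where
  conjugate-edge : edge (π (reflect p q m)) (π (reflect p q r)) ≡ edge (π (p + q ∸ r)) (π (p + q ∸ m))
  conjugate-edge = trans (cong₂ (λ a b → edge (π a) (π b)) (reflect-inside p≤m (≤-trans (<⇒≤ m<r) r≤q))
                                                          (reflect-inside (≤-trans p≤m (<⇒≤ m<r)) r≤q))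
                         (edge-comm _ _)
  words : actIfAdjacent m r (π ∘ reflect p q) (actIfAdjacent p q π w) ≋
          actIfAdjacent p q (π ∘ reflect (p + q ∸ r) (p + q ∸ m)) (actIfAdjacent (p + q ∸ r) (p + q ∸ m) π w)
  words with q ≟ suc p
  ... | yes q≡1+p = contradiction q≡1+p q≢1+p
  ... | no _ with r ≟ suc m | p + q ∸ m ≟ suc (p + q ∸ r)
  ...   | yes _     | yes _   = ≋-reflexive (cong (λ e → act e w) conjugate-edge)
  ...   | yes r≡1+m | no ¬adj = contradiction (Equivalence.to (mirror-adjacent⇔ m<r r≤q) r≡1+m) ¬adj
  ...   | no ¬adj   | yes adj = contradiction (Equivalence.from (mirror-adjacent⇔ m<r r≤q) adj) ¬adj
  ...   | no _      | no _    = ≋-refl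

step-conj : ∀ {p q m r} → p ≤ m → m < r → r ≤ q → ∀ {w π} →
  step m r (step p q (w , π)) ≃ step p q (step (p + q ∸ r) (p + q ∸ m) (w , π))
step-conj {p} {q} {m} {r} p≤m m<r r≤q with m ≟ p | r ≟ q
... | yes refl | yes refl rewrite m+n∸n≡m m r | m+n∸m≡n m r = ≃-refl
... | no m≢p   | _        = step-conj-strict (m≢p ∘ proj₁ ∘ nested-in-adjacent p≤m m<r r≤q) p≤m m<r r≤q
... | yes _    | no r≢q   = step-conj-strict (r≢q ∘ proj₂ ∘ nested-in-adjacent p≤m m<r r≤q) p≤m m<r r≤q

module CactusAction (n : ℕ) where

  stepLetter : State → Letter (CGen n) → State
  stepLetter x (gen g) = step (p g) (q g) x
  stepLetter x (inv g) = step (p g) (q g) x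

  run : State → Word (CGen n) → State
  run = foldl stepLetter

  run-wellFormed : ∀ w {x} → WellFormed x → WellFormed (run x w)
  run-wellFormed []            wf = wf
  run-wellFormed (gen g ∷ w)   wf = run-wellFormed w (step-wellFormed (p g) (q g) wf)
  run-wellFormed (inv g ∷ w)   wf = run-wellFormed w (step-wellFormed (p g) (q g) wf)

  run-resp-≃ : ∀ w {x y} → x ≃ y → run x w ≃ run y w
  run-resp-≃ []          x≃y = x≃y
  run-resp-≃ (gen g ∷ w) x≃y = run-resp-≃ w (step-resp-≃ (p g) (q g) x≃y)
  run-resp-≃ (inv g ∷ w) x≃y = run-resp-≃ w (step-resp-≃ (p g) (q g) x≃y)

  cactusRel-sound : ∀ {l r} → CactusRel n l r → ∀ {x} → WellFormed x → run x l ≃ run x r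
  cactusRel-sound (j1 g) wf = step-involutive (<⇒≤ (p<q g)) wf
  cactusRel-sound (j2 g h (inj₁ g<h)) (_ , π-inj) = step-comm (p<q g) g<h (p<q h) π-inj
  cactusRel-sound (j2 g h (inj₂ h<g)) (_ , π-inj) = ≃-sym (step-comm (p<q h) h<g (p<q g) π-inj)
  cactusRel-sound (j3 g h k g≤h h≤g refl refl) _ = step-conj g≤h (p<q h) h≤g

  run-sound : ∀ {w w′} → J-Eq n w w′ → ∀ {x} → WellFormed x → run x w ≃ run x w′
  run-sound (rel u v {l} {r} l~r) {x} wf
    rewrite foldl-++ stepLetter x u (l ++ v) | foldl-++ stepLetter (run x u) l v
          | foldl-++ stepLetter x u (r ++ v) | foldl-++ stepLetter (run x u) r v =
    run-resp-≃ v (cactusRel-sound l~r (run-wellFormed u wf))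
  run-sound (cancel u v g) {x} wf
    rewrite foldl-++ stepLetter x u (gen g ∷ inv g ∷ v) | foldl-++ stepLetter x u v =
    run-resp-≃ v (step-involutive (<⇒≤ (p<q g)) (run-wellFormed u wf))
  run-sound (cancel′ u v g) {x} wf
    rewrite foldl-++ stepLetter x u (inv g ∷ gen g ∷ v) | foldl-++ stepLetter x u v =
    run-resp-≃ v (step-involutive (<⇒≤ (p<q g)) (run-wellFormed u wf))
  run-sound ≈-refl          wf = ≃-refl
  run-sound (≈-sym e)       wf = ≃-sym (run-sound e wf)
  run-sound (≈-trans e e′)  wf = ≃-trans (run-sound e wf) (run-sound e′ wf)

-- Reading twin words back from states

τ : ℕ → ℕ → ℕ
τ m = reflect m (m + 1)

Far : ℕ → ℕ → Set
Far m m′ = m + 2 ≤ m′ ⊎ m′ + 2 ≤ m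

near-or-far : ∀ m m′ → Far m m′ ⊎ m′ + 1 ≡ m ⊎ m′ ≡ m ⊎ m′ ≡ m + 1
near-or-far zero          zero           = inj₂ (inj₂ (inj₁ refl))
near-or-far zero          (suc zero)     = inj₂ (inj₂ (inj₂ refl))
near-or-far zero          (suc (suc m′)) = inj₁ (inj₁ (s≤s (s≤s z≤n)))
near-or-far (suc zero)    zero           = inj₂ (inj₁ refl)
near-or-far (suc (suc m)) zero           = inj₁ (inj₂ (s≤s (s≤s z≤n)))
near-or-far (suc m)       (suc m′)       =
  Sum.map (Sum.map s≤s s≤s) (Sum.map (cong suc) (Sum.map (cong suc) (cong suc))) (near-or-far m m′)

+2≤⇒+1< : ∀ {m m′} → m + 2 ≤ m′ → m + 1 < m′
+2≤⇒+1< {m} {m′} = subst (_≤ m′) (+-suc m 1)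

τ-fixes-far : ∀ {m m′} → Far m m′ → τ m m′ ≡ m′ × τ m (m′ + 1) ≡ m′ + 1
τ-fixes-far {m} {m′} (inj₁ m+2≤m′) =
  reflect-outside m (m + 1) (inj₂ (+2≤⇒+1< m+2≤m′)) ,
  reflect-outside m (m + 1) (inj₂ (<-trans (+2≤⇒+1< m+2≤m′) (m<m+n m′ z<s)))
τ-fixes-far {m} {m′} (inj₂ m′+2≤m) =
  reflect-outside m (m + 1) (inj₁ (<-trans (m<m+n m′ z<s) (+2≤⇒+1< m′+2≤m))) ,
  reflect-outside m (m + 1) (inj₁ (+2≤⇒+1< m′+2≤m))

τ-comm-far : ∀ {m m′} → Far m m′ → ∀ i → τ m (τ m′ i) ≡ τ m′ (τ m i)
τ-comm-far {m} {m′} (inj₁ m+2≤m′) i = reflect-comm {m} {m + 1} {m′} {m′ + 1} (+2≤⇒+1< m+2≤m′) i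
τ-comm-far {m} {m′} (inj₂ m′+2≤m) i = sym (reflect-comm {m′} {m′ + 1} {m} {m + 1} (+2≤⇒+1< m′+2≤m) i)

τ-start : ∀ m → τ m m ≡ m + 1
τ-start m = reflect-start (m≤m+n m 1)

τ-end : ∀ m → τ m (m + 1) ≡ m
τ-end m = reflect-end (m≤m+n m 1)

far-from-# : ∀ {π : ℕ → ℕ} {m m′} →
  edge (π m) (π (m + 1)) # edge (π (τ m m′)) (π (τ m (m′ + 1))) → Far m m′
far-from-# {π} {m} {m′} e#e′ with Equivalence.from (edge-#⇔ _ _ _ _) e#e′ | near-or-far m m′
... | _ , _ , _ , b≢d | inj₂ (inj₁ refl)        = contradiction (cong π (sym (τ-start (m′ + 1)))) b≢d
... | _ , _ , b≢c , _ | inj₂ (inj₂ (inj₁ refl)) = contradiction (cong π (sym (τ-start m))) b≢c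
... | a≢c , _ , _ , _ | inj₂ (inj₂ (inj₂ refl)) = contradiction (cong π (sym (τ-end m))) a≢c
... | _ | inj₁ far = far

edge-position-unique : ∀ {π} → Injective _≡_ _≡_ π → ∀ {m m′} →
  edge (π m) (π (m + 1)) ≡ edge (π m′) (π (m′ + 1)) → m ≡ m′
edge-position-unique π-inj {m} {m′} eq with edge-injective eq
... | inj₁ (πm≡πm′ , _)         = π-inj πm≡πm′
... | inj₂ (πm≡πm′+1 , πm+1≡πm′) =
  contradiction (trans (π-inj πm≡πm′+1) (cong (_+ 1) (sym (π-inj πm+1≡πm′))))
                (<⇒≢ (<-trans (m<m+n m z<s) (m<m+n (m + 1) z<s)))

module TwinReadback (n : ℕ) where

  open CactusAction n
  open Setoid (presEq-setoid (TwinRel n)) using () renaming (reflexive to Tw-reflexive)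
  module Tw-Reasoning = Relation.Binary.Reasoning.Setoid (presEq-setoid (TwinRel n))

  -- The head letter of the word is the edge swapped by the last twin generator, which is
  -- therefore recorded at the end of the spelled word.
  data Spelling : State → Set where
    []   : ∀ {π} → Spelling ([] , π)
    cons : ∀ {e w π} (t : TGen n) → e ≡ edge (π (idx t)) (π (idx t + 1)) → Spelling (w , π ∘ τ (idx t)) →
           Spelling (e ∷ w , π)

  spell : ∀ {x} → Spelling x → Word (TGen n)
  spell []           = []
  spell (cons t _ s) = spell s ++ gen t ∷ []

  spelling-resp-≗ : ∀ {w π π′} → π ≗ π′ → (s : Spelling (w , π)) →
    Σ (Spelling (w , π′)) λ s′ → spell s′ ≡ spell s
  spelling-resp-≗ π≗π′ []            = [] , refl
  spelling-resp-≗ π≗π′ (cons t e≡ s) with spelling-resp-≗ (π≗π′ ∘ τ (idx t)) s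
  ... | s′ , s′≡s =
    cons t (trans e≡ (cong₂ edge (π≗π′ _) (π≗π′ _))) s′ , cong (_++ gen t ∷ []) s′≡s

  TGen-≡ : ∀ {t t′ : TGen n} → idx t ≡ idx t′ → t ≡ t′
  TGen-≡ {t[ i ] {a} {b}} {t[ .i ] {a′} {b′}} refl rewrite ≤-irrelevant a a′ | ≤-irrelevant b b′ = refl

  spelling-unique : ∀ {w π} → Injective _≡_ _≡_ π → (s s′ : Spelling (w , π)) → spell s ≡ spell s′
  spelling-unique π-inj []             []               = refl
  spelling-unique π-inj (cons t e≡ s) (cons t′ e≡′ s′)
    with TGen-≡ {t} {t′} (edge-position-unique π-inj (trans (sym e≡) e≡′))
  ... | refl = cong (_++ gen t ∷ []) (spelling-unique (reflect-injective (idx t) (idx t + 1) ∘ π-inj) s s′)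

  spelling-swap : ∀ {e e′ w π} → e # e′ → (s : Spelling (e ∷ e′ ∷ w , π)) →
    Σ (Spelling (e′ ∷ e ∷ w , π)) λ s′ → Tw-Eq n (spell s) (spell s′)
  spelling-swap {π = π} e#e′ (cons t refl (cons t′ refl s)) =
    let far                   = far-from-# {π} e#e′
        m′-fixed , m′+1-fixed = τ-fixes-far far
        m-fixed , m+1-fixed   = τ-fixes-far (Sum.swap far)
        s′ , s′≡s             = spelling-resp-≗ (cong π ∘ τ-comm-far far) s
    in cons t′ (cong₂ (λ a b → edge (π a) (π b)) m′-fixed m′+1-fixed)
         (cons t (sym (cong₂ (λ a b → edge (π a) (π b)) m-fixed m+1-fixed)) s′) ,
       (begin
         (spell s ++ gen t′ ∷ []) ++ gen t ∷ []  ≡⟨ ++-assoc (spell s) _ _ ⟩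
         spell s ++ gen t′ ∷ gen t ∷ []          ≈⟨ presEq-relʳ (spell s) (t2 t′ t (Sum.swap far)) ⟩
         spell s ++ gen t ∷ gen t′ ∷ []          ≡⟨ cong (_++ gen t ∷ gen t′ ∷ []) s′≡s ⟨
         spell s′ ++ gen t ∷ gen t′ ∷ []         ≡⟨ ++-assoc (spell s′) _ _ ⟨
         (spell s′ ++ gen t ∷ []) ++ gen t′ ∷ [] ∎)
    where open Tw-Reasoning

  spelling-resp-≋ : ∀ {w w′ π} → w ≋ w′ → (s : Spelling (w , π)) →
    Σ (Spelling (w′ , π)) λ s′ → Tw-Eq n (spell s) (spell s′)
  spelling-resp-≋ ≋-refl        s = s , ≈-refl
  spelling-resp-≋ (≋-trans p q) s with spelling-resp-≋ p s
  ... | s₁ , s≈s₁ with spelling-resp-≋ q s₁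
  ...   | s₂ , s₁≈s₂ = s₂ , ≈-trans s≈s₁ s₁≈s₂
  spelling-resp-≋ (≋-swap e#e′) s = spelling-swap e#e′ s
  spelling-resp-≋ (≋-cons p) (cons t e≡ s) with spelling-resp-≋ p s
  ... | s′ , s≈s′ = cons t e≡ s′ , presEq-++ʳ _ s≈s′

  spelling-resp-≃ : ∀ {x y} → x ≃ y → (s : Spelling x) →
    Σ (Spelling y) λ s′ → Tw-Eq n (spell s) (spell s′)
  spelling-resp-≃ (w≋w′ , π≗π′) s with spelling-resp-≋ w≋w′ s
  ... | s₁ , s≈s₁ with spelling-resp-≗ π≗π′ s₁
  ...   | s₂ , s₂≡s₁ = s₂ , ≈-trans s≈s₁ (Tw-reflexive (sym s₂≡s₁))

  spelling-step : ∀ (t : TGen n) {w π} → Injective _≡_ _≡_ π → (s : Spelling (w , π)) →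
    Σ (Spelling (step (idx t) (idx t + 1) (w , π))) λ s′ → Tw-Eq n (spell s ++ gen t ∷ []) (spell s′)
  spelling-step t {w} {π} π-inj s with idx t + 1 ≟ suc (idx t)
  ... | no ¬adj = contradiction (+-comm (idx t) 1) ¬adj
  ... | yes _ with remove (edge (π (idx t)) (π (idx t + 1))) w in e∈w
  ...   | nothing with spelling-resp-≗ (λ i → cong π (sym (reflect-involutive (idx t) (idx t + 1) i))) s
  ...     | s′ , s′≡s = cons t new-edge s′ , Tw-reflexive (cong (_++ gen t ∷ []) (sym s′≡s))
    where
    new-edge : edge (π (idx t)) (π (idx t + 1)) ≡ edge (π (τ (idx t) (idx t))) (π (τ (idx t) (idx t + 1)))
    new-edge = trans (edge-comm _ _)
                     (sym (cong₂ (λ a b → edge (π a) (π b)) (τ-start (idx t)) (τ-end (idx t))))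
  -- The edge cancels against a letter that commutes to the front; injectivity of π identifies
  -- that letter's twin generator with t, and t t = 1.
  spelling-step t {w} {π} π-inj s | yes _ | just x
    with spelling-resp-≋ (≋-sym (remove-sound _ w e∈w)) s
  ... | cons t′ e≡ s′ , s≈s′ with TGen-≡ {t} {t′} (edge-position-unique π-inj e≡)
  ...   | refl = s′ , (begin
    spell s ++ gen t ∷ []                  ≈⟨ presEq-++ʳ _ s≈s′ ⟩
    (spell s′ ++ gen t ∷ []) ++ gen t ∷ [] ≡⟨ ++-assoc (spell s′) _ _ ⟩
    spell s′ ++ gen t ∷ gen t ∷ []         ≈⟨ presEq-relʳ (spell s′) (t1 t) ⟩
    spell s′ ++ []                         ≡⟨ ++-identityʳ (spell s′) ⟩
    spell s′                               ∎)
    where open Tw-Reasoning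

  spelling-letter : ∀ l {w π} → Injective _≡_ _≡_ π → (s : Spelling (w , π)) →
    Σ (Spelling (run (w , π) (mapWord ι (l ∷ [])))) λ s′ → Tw-Eq n (spell s ++ l ∷ []) (spell s′)
  spelling-letter (gen t) π-inj s = spelling-step t π-inj s
  spelling-letter (inv t) π-inj s =
    let s′ , s≈s′ = spelling-step t π-inj s in s′ , ≈-trans (inv≈gen (t1 t) (spell s) []) s≈s′

  spelling-run : ∀ u {x} → WellFormed x → (s : Spelling x) →
    Σ (Spelling (run x (mapWord ι u))) λ s′ → Tw-Eq n (spell s ++ u) (spell s′)
  spelling-run []      wf s = s , Tw-reflexive (++-identityʳ (spell s))
  spelling-run (l ∷ u) wf s =
    let s₁ , s≈s₁  = spelling-letter l (proj₂ wf) s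
        s₂ , s₁≈s₂ = spelling-run u (run-wellFormed (mapWord ι (l ∷ [])) wf) s₁
    in s₂ , (begin
      spell s ++ l ∷ u         ≡⟨ ++-assoc (spell s) (l ∷ []) u ⟨
      (spell s ++ l ∷ []) ++ u ≈⟨ presEq-++ʳ u s≈s₁ ⟩
      spell s₁ ++ u            ≈⟨ s₁≈s₂ ⟩
      spell s₂                 ∎)
    where open Tw-Reasoning

corollary3p9 : (n : ℕ) → 2 ≤ n → (u v : Word (TGen n)) →
    J-Eq n (mapWord ι u) (mapWord ι v) → Tw-Eq n u v
corollary3p9 n _ u v u≈v =
  let su  , u≈su   = spelling-run u wf₀ []
      sv  , v≈sv   = spelling-run v wf₀ []
      su′ , su≈su′ = spelling-resp-≃ (run-sound u≈v wf₀) su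
  in begin
    u         ≈⟨ u≈su ⟩
    spell su  ≈⟨ su≈su′ ⟩
    spell su′ ≡⟨ spelling-unique (proj₂ (run-wellFormed (mapWord ι v) wf₀)) su′ sv ⟩
    spell sv  ≈⟨ v≈sv ⟨
    v         ∎
  where
  open CactusAction n
  open TwinReadback n
  open Tw-Reasoning
  wf₀ : WellFormed ([] , id)
  wf₀ = tt , id
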